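{- Let $\bm p=(p_1,p_2,p_3)$ be pairwise coprime positive integers, $P=p_1p_2p_3$, $\bm\ell=(\ell_1,\ell_2,\ell_3)\in\mathbb{Z}^3$ with $0<\ell_j<p_j$, and $\chi=\chi_{\bm p}^{\bm\ell}$. Assume (i) $P\equiv2\pmod4$; (ii) $\chi(n)\ne0$ implies $n$ is odd; (iii) $\chi(P-n)=\chi(n)$ for all integers $n$. Let $M,N$ be coprime positive integers and $q=e^{2\pi iM/N}$ (a primitive $N$th root of unity). Then $$2\sum_{n=0}^{PN}\left(1-\frac{n}{PN}\right)\chi(n)q^{\frac{n^2}{4P}}=\sum_{n=0}^{PN}\chi(n)q^{\frac{n^2}{4P}}.$$
   Context: $\chi_{\bm p}^{\bm\ell}(n)=-\epsilon_1\epsilon_2\epsilon_3$ if $n\equiv P\bigl(1+\sum_{j=1}^3\epsilon_j\ell_j/p_j\bigr)\pmod{2P}$ for some $(\epsilon_1,\epsilon_2,\epsilon_3)\in\{\pm1\}^3$, and $0$ otherwise. Fractional powers: $q^x:=e^{2\pi iMx/N}$ for real $x$. -}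

module Defs where

open import Level using (Level)
open import Data.Nat as ℕ using (ℕ)
import Data.Nat.Divisibility as ℕD
open import Data.Integer as ℤ using (ℤ; +_; -[1+_])
open import Data.List using (List; []; _∷_; map; foldr)
open import Data.Product using (_×_; _,_)
open import Relation.Nullary using (yes; no; ¬_)
open import Data.Sum using (_⊎_)
open import Algebra.Bundles using (CommutativeRing)

Triple : Set
Triple = ℤ × ℤ × ℤ

signTriples : List Triple
signTriples =
  (ℤ.+ 1 , ℤ.+ 1 , ℤ.+ 1) ∷ (ℤ.+ 1 , ℤ.+ 1 , ℤ.- ℤ.+ 1) ∷
  (ℤ.+ 1 , ℤ.- ℤ.+ 1 , ℤ.+ 1) ∷ (ℤ.+ 1 , ℤ.- ℤ.+ 1 , ℤ.- ℤ.+ 1) ∷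
  (ℤ.- ℤ.+ 1 , ℤ.+ 1 , ℤ.+ 1) ∷ (ℤ.- ℤ.+ 1 , ℤ.+ 1 , ℤ.- ℤ.+ 1) ∷
  (ℤ.- ℤ.+ 1 , ℤ.- ℤ.+ 1 , ℤ.+ 1) ∷ (ℤ.- ℤ.+ 1 , ℤ.- ℤ.+ 1 , ℤ.- ℤ.+ 1) ∷ []

_≡_[mod_]? : ℤ → ℤ → ℕ → ℤ → ℤ
(a ≡ b [mod m ]?) v with m ℕD.∣? ℤ.∣ a ℤ.- b ∣
... | yes _ = v
... | no  _ = ℤ.+ 0

-- The character χ_p^ℓ(n):  -ε₁ε₂ε₃ if n ≡ P(1 + Σ εⱼ ℓⱼ / pⱼ) (mod 2P) for some
-- sign triple ε, and 0 otherwise.  Here P ℓ₁/p₁ = ℓ₁ p₂ p₃ etc.  Written as a sum over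
-- the eight sign triples of the indicator; under the standing hypotheses
-- (pairwise coprime pⱼ, 0 < ℓⱼ < pⱼ) at most one triple matches.
χ : (p₁ p₂ p₃ ℓ₁ ℓ₂ ℓ₃ : ℕ) → ℤ → ℤ
χ p₁ p₂ p₃ ℓ₁ ℓ₂ ℓ₃ n = foldr ℤ._+_ (ℤ.+ 0) (map term signTriples)
  where
  P : ℕ
  P = p₁ ℕ.* p₂ ℕ.* p₃
  term : Triple → ℤ
  term (e₁ , e₂ , e₃) =
    (n ≡ (+ P ℤ.+ e₁ ℤ.* + (ℓ₁ ℕ.* p₂ ℕ.* p₃)
              ℤ.+ e₂ ℤ.* + (ℓ₂ ℕ.* p₁ ℕ.* p₃)
              ℤ.+ e₃ ℤ.* + (ℓ₃ ℕ.* p₁ ℕ.* p₂)) [mod 2 ℕ.* P ]?)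
      (ℤ.- (e₁ ℤ.* e₂ ℤ.* e₃))

module _ {c ℓ : Level} (R : CommutativeRing c ℓ) where
  open CommutativeRing R hiding (zero)

  pow : Carrier → ℕ → Carrier
  pow x ℕ.zero = 1#
  pow x (ℕ.suc k) = x * pow x k

  natR : ℕ → Carrier
  natR ℕ.zero = 0#
  natR (ℕ.suc k) = 1# + natR k

  intR : ℤ → Carrier
  intR (+ k) = natR k
  intR -[1+ k ] = - natR (ℕ.suc k)

  sumTo : ℕ → (ℕ → Carrier) → Carrier
  sumTo ℕ.zero f = f ℕ.zero
  sumTo (ℕ.suc K) f = sumTo K f + f (ℕ.suc K)

  IsDomain : Set (c Level.⊔ ℓ)
  IsDomain = (1# ≉ 0#) × (∀ x y → x * y ≈ 0# → (x ≈ 0#) ⊎ (y ≈ 0#))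
    where
    open import Relation.Nullary renaming (¬_ to ¬)
    open import Data.Sum renaming (_⊎_ to _⊎_)

  CharZero : Set ℓ
  CharZero = ∀ k → natR (ℕ.suc k) ≉ 0#

  PrimitiveRoot : ℕ → Carrier → Set ℓ
  PrimitiveRoot m ζ = (pow ζ m ≈ 1#) × (∀ k → 0 ℕ.< k → k ℕ.< m → pow ζ k ≉ 1#)

-- Write t(n) = χ(n) ζ^{Mn²} and K = PN.  Everything follows from the reflection symmetry
-- t(K - n) = t(n): summing Σ (K - n) t(n) once as written and once with n ↦ K - n gives
-- 2 Σ (K - n) t(n) = Σ ((K - n) + n) t(n) = K Σ t(n).
--
-- For the symmetry, ζ^{2K} = -1, since it squares to 1 and differs from 1 in a domain.  As χ
-- is odd, (iii) makes it P-antiperiodic, so χ(K - n) = (-1)^{N-1} χ(n).  Writing P = 2o with o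
-- odd, (K - n)² = K² - 2Kn + n² and K² = 2K·oN give ζ^{M(K-n)²} = (-1)^{MoN + Mn} ζ^{Mn²}.
-- If χ(n) ≠ 0 then n is odd, and N - 1 + MoN + Mn is even because M and N are not both even.

module Submission where

open import Defs
open import Level using (Level)
open import Data.Nat as ℕ using (ℕ; _<_; _∸_)
open import Data.Nat.Coprimality using (Coprime)
open import Data.Integer as ℤ using (ℤ; +_)
open import Data.Integer.Divisibility as ℤD using ()
open import Data.Product using (_×_)
open import Relation.Nullary using (¬_)
open import Relation.Binary.PropositionalEquality using (_≡_; _≢_)
open import Algebra.Bundles using (CommutativeRing)

open import Data.Nat using (zero; suc; _≤_; parity)
import Data.Nat.Properties as ℕP
open import Data.Nat.Divisibility using (_∣_; _∣?_; _∣0; ∣-refl; ∣m∣n⇒∣m+n)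
open import Data.Nat.DivMod using (_%_; _/_; m≡m%n+[m/n]*n)
import Data.Nat.Tactic.RingSolver as ℕSolver
open import Data.Integer using (-[1+_])
import Data.Integer.Properties as ℤP
import Data.Integer.Divisibility.Signed as ℤS
import Data.Integer.Tactic.RingSolver as ℤSolver
open import Data.Parity.Base as ℙ using (Parity; 0ℙ; 1ℙ)
import Data.Parity.Properties as ℙP
open import Data.List using (List; []; _∷_; foldr; map; reverse)
import Data.List.Properties as List
import Data.List.Relation.Binary.Permutation.Setoid.Properties as Perm
open import Data.Product using (Σ; _,_; proj₁; proj₂)
open import Data.Sum using (inj₁; inj₂)
open import Data.Empty using (⊥-elim)
open import Function using (_∘_; _⇔_; mk⇔; Equivalence)
open import Relation.Nullary using (yes; no; contradiction)
import Relation.Binary.PropositionalEquality as ≡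
import Algebra.Properties.Semiring.Exp as Exp
import Algebra.Properties.Ring as RingProperties
import Algebra.Properties.CommutativeSemigroup as CommutativeSemigroupProperties

module _ where
  open import Data.Integer using (_+_; _-_; -_; _*_)
  open ≡ using (refl; sym; trans; cong; subst; setoid; module ≡-Reasoning)

  ∑ : List ℤ → ℤ
  ∑ = foldr _+_ (+ 0)

  ∑-map-neg : ∀ xs → ∑ (map -_ xs) ≡ - ∑ xs
  ∑-map-neg [] = refl
  ∑-map-neg (x ∷ xs) = trans (cong (λ s → - x + s) (∑-map-neg xs)) (sym (ℤP.neg-distrib-+ x (∑ xs)))

  ∑-reverse : ∀ xs → ∑ (reverse xs) ≡ ∑ xs
  ∑-reverse xs = Perm.foldr-commMonoid (setoid ℤ) ℤP.+-0-isCommutativeMonoid (Perm.↭-reverse (setoid ℤ) xs)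

  ∣⇒∣-neg-shift : ∀ {k y} → k ℤS.∣ y → k ℤS.∣ - (y + k)
  ∣⇒∣-neg-shift k∣y = ℤS.∣m⇒∣-m (ℤS.∣m∣n⇒∣m+n k∣y ℤS.∣-refl)

  ∣-neg-shift⇒∣ : ∀ {k y} → k ℤS.∣ - (y + k) → k ℤS.∣ y
  ∣-neg-shift⇒∣ {k} {y} k∣z =
    ℤS.∣m+n∣n⇒∣m (subst (k ℤS.∣_) (ℤP.neg-involutive (y + k)) (ℤS.∣m⇒∣-m k∣z)) ℤS.∣-refl

  private
    neg-sub-split : ∀ x c c′ → - x - c ≡ - ((x - c′) + (c + c′))
    neg-sub-split = ℤSolver.solve-∀

  ∣-reflect : ∀ {m x c c′} → c + c′ ≡ + m → m ∣ ℤ.∣ - x - c ∣ ⇔ m ∣ ℤ.∣ x - c′ ∣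
  ∣-reflect {m} {x} {c} {c′} c+c′≡m = mk⇔
    (λ m∣l → ℤS.∣⇒∣ᵤ (∣-neg-shift⇒∣ {y = x - c′} (subst (+ m ℤS.∣_) reflect (ℤS.∣ᵤ⇒∣ m∣l))))
    (λ m∣r → ℤS.∣⇒∣ᵤ (subst (+ m ℤS.∣_) (sym reflect) (∣⇒∣-neg-shift (ℤS.∣ᵤ⇒∣ {i = x - c′} m∣r))))
    where
    reflect : - x - c ≡ - ((x - c′) + + m)
    reflect = trans (neg-sub-split x c c′) (cong (λ s → - ((x - c′) + s)) c+c′≡m)

  mod?-neg : ∀ {m x c c′ v v′} → c + c′ ≡ + m → v ≡ - v′ →
             ((- x) ≡ c [mod m ]?) v ≡ - ((x ≡ c′ [mod m ]?) v′)
  mod?-neg {m} {x} {c} {c′} c+c′≡m v≡-v′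
    with m ∣? ℤ.∣ - x - c ∣ | m ∣? ℤ.∣ x - c′ ∣
  ... | yes _   | yes _   = v≡-v′
  ... | no _    | no _    = refl
  ... | yes m∣l | no m∤r  = ⊥-elim (m∤r (Equivalence.to (∣-reflect {m} {x} {c} {c′} c+c′≡m) m∣l))
  ... | no m∤l  | yes m∣r = ⊥-elim (m∤l (Equivalence.from (∣-reflect {m} {x} {c} {c′} c+c′≡m) m∣r))

  private
    centres-sum : ∀ P e₁ e₂ e₃ a b c →
      (P + e₁ * a + e₂ * b + e₃ * c) + (P + (- e₁) * a + (- e₂) * b + (- e₃) * c) ≡ P + P
    centres-sum = ℤSolver.solve-∀

    sign-neg : ∀ e₁ e₂ e₃ → - (e₁ * e₂ * e₃) ≡ - (- ((- e₁) * (- e₂) * (- e₃)))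
    sign-neg = ℤSolver.solve-∀

  module _ (p₁ p₂ p₃ ℓ₁ ℓ₂ ℓ₃ : ℕ) where
    private
      P : ℕ
      P = p₁ ℕ.* p₂ ℕ.* p₃

      P+P≡2P : + P + + P ≡ + (2 ℕ.* P)
      P+P≡2P = trans (sym (ℤP.pos-+ P P)) (cong (λ Q → + (P ℕ.+ Q)) (sym (ℕP.+-identityʳ P)))

    centre : Triple → ℤ
    centre (e₁ , e₂ , e₃) =
      + P + e₁ * + (ℓ₁ ℕ.* p₂ ℕ.* p₃) + e₂ * + (ℓ₂ ℕ.* p₁ ℕ.* p₃) + e₃ * + (ℓ₃ ℕ.* p₁ ℕ.* p₂)

    -- χ x unfolds to ∑ (map (χ-summand x) signTriples), and map neg³ signTriples
    -- computes to reverse signTriples; χ-neg uses both by computation.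
    χ-summand : ℤ → Triple → ℤ
    χ-summand x (e₁ , e₂ , e₃) = (x ≡ centre (e₁ , e₂ , e₃) [mod 2 ℕ.* P ]?) (- (e₁ * e₂ * e₃))

    neg³ : Triple → Triple
    neg³ (e₁ , e₂ , e₃) = (- e₁ , - e₂ , - e₃)

    χ-summand-neg : ∀ x ε → χ-summand (- x) ε ≡ - χ-summand x (neg³ ε)
    χ-summand-neg x (e₁ , e₂ , e₃) =
      mod?-neg (trans (centres-sum (+ P) e₁ e₂ e₃ _ _ _) P+P≡2P) (sign-neg e₁ e₂ e₃)

    χ-neg : ∀ x → χ p₁ p₂ p₃ ℓ₁ ℓ₂ ℓ₃ (- x) ≡ - χ p₁ p₂ p₃ ℓ₁ ℓ₂ ℓ₃ x
    χ-neg x = begin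
      ∑ (map (χ-summand (- x)) signTriples)            ≡⟨ cong ∑ (List.map-cong (χ-summand-neg x) signTriples) ⟩
      ∑ (map (-_ ∘ χ-summand x ∘ neg³) signTriples)     ≡⟨ cong ∑ (List.map-∘ {g = -_} {f = χ-summand x ∘ neg³} signTriples) ⟩
      ∑ (map -_ (map (χ-summand x ∘ neg³) signTriples)) ≡⟨ ∑-map-neg (map (χ-summand x ∘ neg³) signTriples) ⟩
      - ∑ (reverse (map (χ-summand x) signTriples))    ≡⟨ cong -_ (∑-reverse (map (χ-summand x) signTriples)) ⟩
      - ∑ (map (χ-summand x) signTriples)              ∎
      where open ≡-Reasoning

  private
    add-sub : ∀ a b → b ≡ a + b - a
    add-sub = ℤSolver.solve-∀
    sub-regroup : ∀ p q a → p + q - a ≡ q + (p - a)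
    sub-regroup = ℤSolver.solve-∀

  reflected-offset : ∀ {P k n m} → n ℕ.+ m ≡ P ℕ.* suc k → + m ≡ + (k ℕ.* P) + (+ P - + n)
  reflected-offset {P} {k} {n} {m} n+m≡P[1+k] = begin
    + m                        ≡⟨ add-sub (+ n) (+ m) ⟩
    + n + + m - + n            ≡⟨ cong (_- + n) (trans (sym (ℤP.pos-+ n m)) (cong +_ n+m≡P+kP)) ⟩
    + (P ℕ.+ k ℕ.* P) - + n    ≡⟨ cong (_- + n) (ℤP.pos-+ P (k ℕ.* P)) ⟩
    + P + + (k ℕ.* P) - + n    ≡⟨ sub-regroup (+ P) (+ (k ℕ.* P)) (+ n) ⟩
    + (k ℕ.* P) + (+ P - + n)  ∎
    where
    open ≡-Reasoning
    n+m≡P+kP : n ℕ.+ m ≡ P ℕ.+ k ℕ.* P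
    n+m≡P+kP = trans n+m≡P[1+k] (ℕP.*-comm P (suc k))

  odd∧reflective⇒antiperiodic : ∀ (f : ℤ → ℤ) p → (∀ x → f (- x) ≡ - f x) → (∀ x → f (p - x) ≡ f x) →
                                ∀ x → f (p + x) ≡ - f x
  odd∧reflective⇒antiperiodic f p odd reflective x = begin
    f (p + x)      ≡⟨ cong (λ y → f (p + y)) (sym (ℤP.neg-involutive x)) ⟩
    f (p - (- x))  ≡⟨ reflective (- x) ⟩
    f (- x)        ≡⟨ odd x ⟩
    - f x          ∎
    where open ≡-Reasoning

module _ where
  open ≡ using (refl; sym; trans; cong; cong₂; module ≡-Reasoning)

  parity≡0ℙ⇒2∣ : ∀ n → parity n ≡ 0ℙ → 2 ∣ n
  parity≡0ℙ⇒2∣ zero _ = 2 ∣0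
  parity≡0ℙ⇒2∣ (suc (suc n)) even = ∣m∣n⇒∣m+n ∣-refl (parity≡0ℙ⇒2∣ n even)

  ¬2∣⇒parity≡1ℙ : ∀ n → ¬ 2 ∣ n → parity n ≡ 1ℙ
  ¬2∣⇒parity≡1ℙ n 2∤n with parity n in eq
  ... | 0ℙ = contradiction (parity≡0ℙ⇒2∣ n eq) 2∤n
  ... | 1ℙ = refl

  coprime⇒¬both-even : ∀ {m n} → Coprime m n → ¬ (parity m ≡ 0ℙ × parity n ≡ 0ℙ)
  coprime⇒¬both-even {m} {n} coprime (m-even , n-even) =
    contradiction (coprime (parity≡0ℙ⇒2∣ m m-even , parity≡0ℙ⇒2∣ n n-even)) λ ()

  private
    regroup : ∀ a → 2 ℕ.+ a ℕ.* 4 ≡ 2 ℕ.* (1 ℕ.+ 2 ℕ.* a)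
    regroup = ℕSolver.solve-∀

  ≡2[mod4]⇒2*odd : ∀ P → P % 4 ≡ 2 → Σ ℕ λ o → P ≡ 2 ℕ.* o × parity o ≡ 1ℙ
  ≡2[mod4]⇒2*odd P P≡2 = 1 ℕ.+ 2 ℕ.* a , P≡2o , o-odd
    where
    a : ℕ
    a = P / 4
    P≡2o : P ≡ 2 ℕ.* (1 ℕ.+ 2 ℕ.* a)
    P≡2o = trans (m≡m%n+[m/n]*n P 4) (trans (cong (ℕ._+ a ℕ.* 4) P≡2) (regroup a))
    o-odd : parity (1 ℕ.+ 2 ℕ.* a) ≡ 1ℙ
    o-odd = trans (ℙP.+-homo-+ 1 (2 ℕ.* a)) (cong (1ℙ ℙ.+_) (ℙP.*-homo-* 2 a))

  private
    signs-cancel : ∀ m n′ → ¬ (m ≡ 0ℙ × 1ℙ ℙ.+ n′ ≡ 0ℙ) →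
                   n′ ℙ.+ (m ℙ.* (1ℙ ℙ.+ n′) ℙ.+ m) ≡ 0ℙ
    signs-cancel 0ℙ 0ℙ _ = refl
    signs-cancel 0ℙ 1ℙ not-both-even = contradiction (refl , refl) not-both-even
    signs-cancel 1ℙ 0ℙ _ = refl
    signs-cancel 1ℙ 1ℙ _ = refl

  sign-exponent-even : ∀ {M o N′ n} → parity o ≡ 1ℙ → parity n ≡ 1ℙ →
    ¬ (parity M ≡ 0ℙ × parity (suc N′) ≡ 0ℙ) →
    parity (N′ ℕ.+ (M ℕ.* o ℕ.* suc N′ ℕ.+ M ℕ.* n)) ≡ 0ℙ
  sign-exponent-even {M} {o} {N′} {n} o-odd n-odd not-both-even = begin
    parity (N′ ℕ.+ (M ℕ.* o ℕ.* suc N′ ℕ.+ M ℕ.* n))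
      ≡⟨ ℙP.+-homo-+ N′ _ ⟩
    pN′ ℙ.+ parity (M ℕ.* o ℕ.* suc N′ ℕ.+ M ℕ.* n)
      ≡⟨ cong (pN′ ℙ.+_) (ℙP.+-homo-+ (M ℕ.* o ℕ.* suc N′) (M ℕ.* n)) ⟩
    pN′ ℙ.+ (parity (M ℕ.* o ℕ.* suc N′) ℙ.+ parity (M ℕ.* n))
      ≡⟨ cong (pN′ ℙ.+_) (cong₂ ℙ._+_ Mo[1+N′]-parity (M*odd-parity n-odd)) ⟩
    pN′ ℙ.+ (pM ℙ.* (1ℙ ℙ.+ pN′) ℙ.+ pM)
      ≡⟨ signs-cancel pM pN′ (λ (M-even , N-even) → not-both-even (M-even , trans (ℙP.+-homo-+ 1 N′) N-even)) ⟩
    0ℙ ∎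
    where
    open ≡-Reasoning
    pM pN′ : Parity
    pM = parity M
    pN′ = parity N′
    M*odd-parity : ∀ {k} → parity k ≡ 1ℙ → parity (M ℕ.* k) ≡ pM
    M*odd-parity {k} k-odd = trans (ℙP.*-homo-* M k) (trans (cong (pM ℙ.*_) k-odd) (ℙP.*-identityʳ pM))
    Mo[1+N′]-parity : parity (M ℕ.* o ℕ.* suc N′) ≡ pM ℙ.* (1ℙ ℙ.+ pN′)
    Mo[1+N′]-parity = trans (ℙP.*-homo-* (M ℕ.* o) (suc N′)) (cong₂ ℙ._*_ (M*odd-parity o-odd) (ℙP.+-homo-+ 1 N′))

  private
    square-expansion : ∀ M n m → M ℕ.* m ℕ.* m ℕ.+ 2 ℕ.* (n ℕ.+ m) ℕ.* (2 ℕ.* (M ℕ.* n))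
      ≡ M ℕ.* (n ℕ.+ m) ℕ.* (n ℕ.+ m) ℕ.+ 2 ℕ.* (n ℕ.+ m) ℕ.* (M ℕ.* n) ℕ.+ M ℕ.* n ℕ.* n
    square-expansion = ℕSolver.solve-∀

    square-regroup : ∀ M o N n K → M ℕ.* K ℕ.* (2 ℕ.* o ℕ.* N) ℕ.+ 2 ℕ.* K ℕ.* (M ℕ.* n) ℕ.+ M ℕ.* n ℕ.* n
      ≡ 2 ℕ.* K ℕ.* (M ℕ.* o ℕ.* N ℕ.+ M ℕ.* n) ℕ.+ M ℕ.* n ℕ.* n
    square-regroup = ℕSolver.solve-∀

  -- With m = K - n: m² + 4Kn = (K + n)² = K² + 2Kn + n², and K² = 2K · oN.
  reflected-square : ∀ M o N {n m K} → n ℕ.+ m ≡ K → K ≡ 2 ℕ.* o ℕ.* N →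
    M ℕ.* m ℕ.* m ℕ.+ 2 ℕ.* K ℕ.* (2 ℕ.* (M ℕ.* n)) ≡ 2 ℕ.* K ℕ.* (M ℕ.* o ℕ.* N ℕ.+ M ℕ.* n) ℕ.+ M ℕ.* n ℕ.* n
  reflected-square M o N {n} {m} refl K≡2oN = begin
    M ℕ.* m ℕ.* m ℕ.+ 2 ℕ.* K ℕ.* (2 ℕ.* (M ℕ.* n))          ≡⟨ square-expansion M n m ⟩
    M ℕ.* K ℕ.* K ℕ.+ 2 ℕ.* K ℕ.* (M ℕ.* n) ℕ.+ M ℕ.* n ℕ.* n ≡⟨ cong (λ k → M ℕ.* K ℕ.* k ℕ.+ 2 ℕ.* K ℕ.* (M ℕ.* n) ℕ.+ M ℕ.* n ℕ.* n) K≡2oN ⟩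
    M ℕ.* K ℕ.* (2 ℕ.* o ℕ.* N) ℕ.+ 2 ℕ.* K ℕ.* (M ℕ.* n) ℕ.+ M ℕ.* n ℕ.* n ≡⟨ square-regroup M o N n K ⟩
    2 ℕ.* K ℕ.* (M ℕ.* o ℕ.* N ℕ.+ M ℕ.* n) ℕ.+ M ℕ.* n ℕ.* n ∎
    where
    open ≡-Reasoning
    K : ℕ
    K = n ℕ.+ m

module _ {c ℓ : Level} (R : CommutativeRing c ℓ) where
  open CommutativeRing R
  open Exp semiring using (_^_; ^-homo-*; ^-congˡ; ^-congʳ; ^-assocʳ)
  open RingProperties ring
    using (-1*x≈-x; x[y-z]≈xy-xz; -0#≈0#; -‿involutive; x∙y⁻¹≈ε⇒x≈y; +-inverseˡ-unique)
  open import Relation.Binary.Reasoning.Setoid setoid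
  open CommutativeSemigroupProperties +-commutativeSemigroup using (interchange)
  open CommutativeSemigroupProperties *-commutativeSemigroup renaming (interchange to *-interchange)

  pow≈^ : ∀ x k → pow R x k ≈ x ^ k
  pow≈^ x zero = refl
  pow≈^ x (suc k) = *-congˡ (pow≈^ x k)

  natR-+ : ∀ a b → natR R (a ℕ.+ b) ≈ natR R a + natR R b
  natR-+ zero b = sym (+-identityˡ _)
  natR-+ (suc a) b = trans (+-congˡ (natR-+ a b)) (sym (+-assoc _ _ _))

  natR-2* : ∀ x → natR R 2 * x ≈ x + x
  natR-2* x = begin
    (1# + (1# + 0#)) * x  ≈⟨ *-congʳ (+-congˡ (+-identityʳ 1#)) ⟩
    (1# + 1#) * x         ≈⟨ distribʳ x 1# 1# ⟩
    1# * x + 1# * x       ≈⟨ +-cong (*-identityˡ x) (*-identityˡ x) ⟩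
    x + x                 ∎

  intR-neg : ∀ z → intR R (ℤ.- z) ≈ - intR R z
  intR-neg (+ zero) = sym -0#≈0#
  intR-neg (+ suc k) = refl
  intR-neg -[1+ k ] = sym (-‿involutive _)

  -1^even≈1 : ∀ k → parity k ≡ 0ℙ → (- 1#) ^ k ≈ 1#
  -1^even≈1 zero _ = refl
  -1^even≈1 (suc zero) ()
  -1^even≈1 (suc (suc k)) even = begin
    - 1# * (- 1# * (- 1#) ^ k) ≈⟨ -1*x≈-x _ ⟩
    - (- 1# * (- 1#) ^ k)      ≈⟨ -‿cong (-1*x≈-x _) ⟩
    - - ((- 1#) ^ k)           ≈⟨ -‿involutive _ ⟩
    (- 1#) ^ k                 ≈⟨ -1^even≈1 k even ⟩
    1#                         ∎

  square≈1⇒≈-1 : IsDomain R → ∀ {u} → u * u ≈ 1# → ¬ (u ≈ 1#) → u ≈ - 1#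
  square≈1⇒≈-1 (_ , noZeroDivisors) {u} u²≈1 u≉1
    with noZeroDivisors (u + 1#) (u - 1#) product≈0
    where
    product≈0 : (u + 1#) * (u - 1#) ≈ 0#
    product≈0 = begin
      (u + 1#) * (u - 1#)           ≈⟨ x[y-z]≈xy-xz (u + 1#) u 1# ⟩
      (u + 1#) * u - (u + 1#) * 1#  ≈⟨ +-congˡ (-‿cong (trans (*-identityʳ _) (sym [u+1]u≈u+1))) ⟩
      (u + 1#) * u - (u + 1#) * u   ≈⟨ -‿inverseʳ _ ⟩
      0#                            ∎
      where
      [u+1]u≈u+1 : (u + 1#) * u ≈ u + 1#
      [u+1]u≈u+1 = begin
        (u + 1#) * u    ≈⟨ distribʳ u u 1# ⟩
        u * u + 1# * u  ≈⟨ +-cong u²≈1 (*-identityˡ u) ⟩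
        1# + u          ≈⟨ +-comm 1# u ⟩
        u + 1#          ∎
  ... | inj₁ u+1≈0 = +-inverseˡ-unique u 1# u+1≈0
  ... | inj₂ u-1≈0 = ⊥-elim (u≉1 (x∙y⁻¹≈ε⇒x≈y u 1# u-1≈0))

  primitiveRoot⇒half≈-1 : IsDomain R → ∀ {h ζ} → 0 < h → PrimitiveRoot R (2 ℕ.* h) ζ → ζ ^ h ≈ - 1#
  primitiveRoot⇒half≈-1 domain {h} {ζ} 0<h (ζ^2h≈1 , minimal) = square≈1⇒≈-1 domain ζ^h²≈1 ζ^h≉1
    where
    2h≡h+h : 2 ℕ.* h ≡ h ℕ.+ h
    2h≡h+h = ≡.cong (h ℕ.+_) (ℕP.+-identityʳ h)

    ζ^h²≈1 : ζ ^ h * ζ ^ h ≈ 1#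
    ζ^h²≈1 = begin
      ζ ^ h * ζ ^ h     ≈⟨ ^-homo-* ζ h h ⟨
      ζ ^ (h ℕ.+ h)     ≈⟨ ^-congʳ ζ (≡.sym 2h≡h+h) ⟩
      ζ ^ (2 ℕ.* h)     ≈⟨ pow≈^ ζ (2 ℕ.* h) ⟨
      pow R ζ (2 ℕ.* h) ≈⟨ ζ^2h≈1 ⟩
      1#                ∎

    ζ^h≉1 : ¬ (ζ ^ h ≈ 1#)
    ζ^h≉1 ζ^h≈1 = minimal h 0<h (≡.subst (h <_) (≡.sym 2h≡h+h) (ℕP.m<m+n h 0<h)) (trans (pow≈^ ζ h) ζ^h≈1)

  antiperiodic⇒-1^ : ∀ (g : ℤ → Carrier) P → (∀ x → g (+ P ℤ.+ x) ≈ - g x) →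
                     ∀ k x → g (+ (k ℕ.* P) ℤ.+ x) ≈ (- 1#) ^ k * g x
  antiperiodic⇒-1^ g P antiperiodic zero x =
    trans (reflexive (≡.cong g (ℤP.+-identityˡ x))) (sym (*-identityˡ (g x)))
  antiperiodic⇒-1^ g P antiperiodic (suc k) x = begin
    g (+ (P ℕ.+ k ℕ.* P) ℤ.+ x)     ≈⟨ reflexive (≡.cong g shift) ⟩
    g (+ P ℤ.+ (+ (k ℕ.* P) ℤ.+ x)) ≈⟨ antiperiodic _ ⟩
    - g (+ (k ℕ.* P) ℤ.+ x)         ≈⟨ -1*x≈-x _ ⟨
    - 1# * g (+ (k ℕ.* P) ℤ.+ x)    ≈⟨ *-congˡ (antiperiodic⇒-1^ g P antiperiodic k x) ⟩
    - 1# * ((- 1#) ^ k * g x)       ≈⟨ *-assoc _ _ _ ⟨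
    (- 1#) ^ suc k * g x            ∎
    where
    shift : + (P ℕ.+ k ℕ.* P) ℤ.+ x ≡ + P ℤ.+ (+ (k ℕ.* P) ℤ.+ x)
    shift = ≡.trans (≡.cong (ℤ._+ x) (ℤP.pos-+ P (k ℕ.* P))) (ℤP.+-assoc (+ P) (+ (k ℕ.* P)) x)

  sumTo-cong : ∀ K {f g} → (∀ n → n ≤ K → f n ≈ g n) → sumTo R K f ≈ sumTo R K g
  sumTo-cong zero f≈g = f≈g 0 ℕ.z≤n
  sumTo-cong (suc K) f≈g = +-cong (sumTo-cong K (λ n n≤K → f≈g n (ℕP.m≤n⇒m≤1+n n≤K))) (f≈g (suc K) ℕP.≤-refl)

  sumTo-+ : ∀ K f g → sumTo R K (λ n → f n + g n) ≈ sumTo R K f + sumTo R K g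
  sumTo-+ zero f g = refl
  sumTo-+ (suc K) f g = trans (+-congʳ (sumTo-+ K f g)) (interchange _ _ _ _)

  sumTo-*ˡ : ∀ K a f → sumTo R K (λ n → a * f n) ≈ a * sumTo R K f
  sumTo-*ˡ zero a f = refl
  sumTo-*ˡ (suc K) a f = trans (+-congʳ (sumTo-*ˡ K a f)) (sym (distribˡ a _ _))

  sumTo-suc : ∀ K f → sumTo R (suc K) f ≈ f 0 + sumTo R K (λ n → f (suc n))
  sumTo-suc zero f = refl
  sumTo-suc (suc K) f = trans (+-congʳ (sumTo-suc K f)) (+-assoc _ _ _)

  sumTo-reverse : ∀ K f → sumTo R K f ≈ sumTo R K (λ n → f (K ∸ n))
  sumTo-reverse zero f = refl
  sumTo-reverse (suc K) f = begin
    sumTo R K f + f (suc K)                    ≈⟨ +-congʳ (sumTo-reverse K f) ⟩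
    sumTo R K (λ n → f (K ∸ n)) + f (suc K)    ≈⟨ +-comm _ _ ⟩
    f (suc K) + sumTo R K (λ n → f (K ∸ n))    ≈⟨ sumTo-suc K (λ n → f (suc K ∸ n)) ⟨
    sumTo R (suc K) (λ n → f (suc K ∸ n))      ∎

  sumTo-weight-symmetric : ∀ K f → (∀ {n m} → n ℕ.+ m ≡ K → f m ≈ f n) →
    natR R 2 * sumTo R K (λ n → natR R (K ∸ n) * f n) ≈ natR R K * sumTo R K f
  sumTo-weight-symmetric K f symmetric = begin
    natR R 2 * A                                          ≈⟨ natR-2* A ⟩
    A + A                                                 ≈⟨ +-congˡ A≈Σnf ⟩
    A + sumTo R K (λ n → natR R n * f n)                  ≈⟨ sumTo-+ K _ _ ⟨
    sumTo R K (λ n → natR R (K ∸ n) * f n + natR R n * f n) ≈⟨ sumTo-cong K weights-add-up ⟩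
    sumTo R K (λ n → natR R K * f n)                      ≈⟨ sumTo-*ˡ K (natR R K) f ⟩
    natR R K * sumTo R K f                                ∎
    where
    A : Carrier
    A = sumTo R K (λ n → natR R (K ∸ n) * f n)

    A≈Σnf : A ≈ sumTo R K (λ n → natR R n * f n)
    A≈Σnf = trans (sumTo-reverse K _) (sumTo-cong K λ n n≤K →
      *-cong (reflexive (≡.cong (natR R) (ℕP.m∸[m∸n]≡n n≤K))) (symmetric (ℕP.m+[n∸m]≡n n≤K)))

    weights-add-up : ∀ n → n ≤ K → natR R (K ∸ n) * f n + natR R n * f n ≈ natR R K * f n
    weights-add-up n n≤K = begin
      natR R (K ∸ n) * f n + natR R n * f n ≈⟨ distribʳ (f n) _ _ ⟨
      (natR R (K ∸ n) + natR R n) * f n     ≈⟨ *-congʳ (natR-+ (K ∸ n) n) ⟨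
      natR R (K ∸ n ℕ.+ n) * f n            ≈⟨ *-congʳ (reflexive (≡.cong (natR R) (ℕP.m∸n+n≡m n≤K))) ⟩
      natR R K * f n                        ∎

  module ReflectionSymmetry
    (domain : IsDomain R) (f : ℤ → ℤ) (f-odd : ∀ x → f (ℤ.- x) ≡ ℤ.- f x)
    (P : ℕ) (P≡2[mod4] : P % 4 ≡ 2)
    (odd-support : ∀ n → f n ≢ + 0 → ¬ (+ 2 ℤD.∣ n))
    (reflective : ∀ n → f (+ P ℤ.- n) ≡ f n)
    (M N′ : ℕ) (coprime : Coprime M (suc N′))
    (ζ : Carrier) (ζ-primitive : PrimitiveRoot R (4 ℕ.* P ℕ.* suc N′) ζ)
    where

    N K : ℕ
    N = suc N′
    K = P ℕ.* N

    term : ℕ → Carrier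
    term n = intR R (f (+ n)) * pow R ζ (M ℕ.* n ℕ.* n)

    o : ℕ
    o = proj₁ (≡2[mod4]⇒2*odd P P≡2[mod4])

    o-odd : parity o ≡ 1ℙ
    o-odd = proj₂ (proj₂ (≡2[mod4]⇒2*odd P P≡2[mod4]))

    K≡2oN : K ≡ 2 ℕ.* o ℕ.* N
    K≡2oN = ≡.cong (ℕ._* N) (proj₁ (proj₂ (≡2[mod4]⇒2*odd P P≡2[mod4])))

    private
      4PN≡2[2K] : ∀ P N → 4 ℕ.* P ℕ.* N ≡ 2 ℕ.* (2 ℕ.* (P ℕ.* N))
      4PN≡2[2K] = ℕSolver.solve-∀

    ζ^2K≈-1 : ζ ^ (2 ℕ.* K) ≈ - 1#
    ζ^2K≈-1 = primitiveRoot⇒half≈-1 domain 0<2K (≡.subst (λ m → PrimitiveRoot R m ζ) (4PN≡2[2K] P N) ζ-primitive)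
      where
      0<2K : 0 < 2 ℕ.* K
      0<2K = ≡.subst (λ k → 0 < 2 ℕ.* k) (≡.sym K≡2oN) ℕ.z<s

    ζ^[2K*j]≈-1^j : ∀ j → ζ ^ (2 ℕ.* K ℕ.* j) ≈ (- 1#) ^ j
    ζ^[2K*j]≈-1^j j = trans (sym (^-assocʳ ζ (2 ℕ.* K) j)) (^-congˡ j ζ^2K≈-1)

    ζ-reflect : ∀ {n m} → n ℕ.+ m ≡ K →
                ζ ^ (M ℕ.* m ℕ.* m) ≈ (- 1#) ^ (M ℕ.* o ℕ.* N ℕ.+ M ℕ.* n) * ζ ^ (M ℕ.* n ℕ.* n)
    ζ-reflect {n} {m} n+m≡K = begin
      ζ ^ Mm²                                      ≈⟨ *-identityʳ (ζ ^ Mm²) ⟨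
      ζ ^ Mm² * 1#                                 ≈⟨ *-congˡ (-1^even≈1 (2 ℕ.* Mn) (ℙP.*-homo-* 2 Mn)) ⟨
      ζ ^ Mm² * (- 1#) ^ (2 ℕ.* Mn)                ≈⟨ *-congˡ (ζ^[2K*j]≈-1^j (2 ℕ.* Mn)) ⟨
      ζ ^ Mm² * ζ ^ (2 ℕ.* K ℕ.* (2 ℕ.* Mn))       ≈⟨ ^-homo-* ζ Mm² (2 ℕ.* K ℕ.* (2 ℕ.* Mn)) ⟨
      ζ ^ (Mm² ℕ.+ 2 ℕ.* K ℕ.* (2 ℕ.* Mn))         ≈⟨ ^-congʳ ζ (reflected-square M o N n+m≡K K≡2oN) ⟩
      ζ ^ (2 ℕ.* K ℕ.* E ℕ.+ Mn²)                  ≈⟨ ^-homo-* ζ (2 ℕ.* K ℕ.* E) Mn² ⟩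
      ζ ^ (2 ℕ.* K ℕ.* E) * ζ ^ Mn²                ≈⟨ *-congʳ (ζ^[2K*j]≈-1^j E) ⟩
      (- 1#) ^ E * ζ ^ Mn²                         ∎
      where
      Mn Mm² Mn² E : ℕ
      Mn = M ℕ.* n
      Mm² = M ℕ.* m ℕ.* m
      Mn² = M ℕ.* n ℕ.* n
      E = M ℕ.* o ℕ.* N ℕ.+ M ℕ.* n

    f-reflect : ∀ {n m} → n ℕ.+ m ≡ K → intR R (f (+ m)) ≈ (- 1#) ^ N′ * intR R (f (+ n))
    f-reflect {n} {m} n+m≡K = begin
      intR R (f (+ m))                            ≈⟨ reflexive (≡.cong (intR R ∘ f) (reflected-offset n+m≡K)) ⟩
      intR R (f (+ (N′ ℕ.* P) ℤ.+ (+ P ℤ.- + n))) ≈⟨ antiperiodic⇒-1^ (intR R ∘ f) P f-antiperiodic N′ _ ⟩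
      (- 1#) ^ N′ * intR R (f (+ P ℤ.- + n))      ≈⟨ *-congˡ (reflexive (≡.cong (intR R) (reflective (+ n)))) ⟩
      (- 1#) ^ N′ * intR R (f (+ n))              ∎
      where
      f-antiperiodic : ∀ x → intR R (f (+ P ℤ.+ x)) ≈ - intR R (f x)
      f-antiperiodic x = trans (reflexive (≡.cong (intR R) (odd∧reflective⇒antiperiodic f (+ P) f-odd reflective x)))
                               (intR-neg (f x))

    term-reflect : ∀ {n m} → n ℕ.+ m ≡ K → term m ≈ term n
    term-reflect {n} {m} n+m≡K = begin
      term m                                                   ≈⟨ *-cong (f-reflect {n} {m} n+m≡K) ζ-part ⟩
      ((- 1#) ^ N′ * fn) * ((- 1#) ^ E * ζ ^ (M ℕ.* n ℕ.* n))  ≈⟨ *-interchange _ _ _ _ ⟩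
      ((- 1#) ^ N′ * (- 1#) ^ E) * (fn * ζ ^ (M ℕ.* n ℕ.* n))  ≈⟨ *-cong (^-homo-* (- 1#) N′ E) (*-congˡ (pow≈^ ζ (M ℕ.* n ℕ.* n))) ⟨
      (- 1#) ^ (N′ ℕ.+ E) * term n                             ≈⟨ sign-vanishes ⟩
      term n                                                   ∎
      where
      E : ℕ
      E = M ℕ.* o ℕ.* N ℕ.+ M ℕ.* n
      fn : Carrier
      fn = intR R (f (+ n))

      ζ-part : pow R ζ (M ℕ.* m ℕ.* m) ≈ (- 1#) ^ E * ζ ^ (M ℕ.* n ℕ.* n)
      ζ-part = trans (pow≈^ ζ (M ℕ.* m ℕ.* m)) (ζ-reflect {n} {m} n+m≡K)

      sign-vanishes : (- 1#) ^ (N′ ℕ.+ E) * term n ≈ term n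
      sign-vanishes with f (+ n) ℤ.≟ + 0
      ... | yes fn≡0 = trans (*-congˡ term≈0) (trans (zeroʳ _) (sym term≈0))
        where
        term≈0 : term n ≈ 0#
        term≈0 = trans (*-congʳ (reflexive (≡.cong (intR R) fn≡0))) (zeroˡ _)
      ... | no fn≢0 = trans (*-congʳ (-1^even≈1 (N′ ℕ.+ E) E-even)) (*-identityˡ _)
        where
        E-even : parity (N′ ℕ.+ E) ≡ 0ℙ
        E-even = sign-exponent-even {M} {o} {N′} {n}
          o-odd (¬2∣⇒parity≡1ℙ n (odd-support (+ n) fn≢0)) (coprime⇒¬both-even coprime)

lemma3p1 : (p₁ p₂ p₃ : ℕ) → 0 < p₁ → 0 < p₂ → 0 < p₃ →
  Coprime p₁ p₂ → Coprime p₁ p₃ → Coprime p₂ p₃ →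
  (ℓ₁ ℓ₂ ℓ₃ : ℕ) → 0 < ℓ₁ → ℓ₁ < p₁ → 0 < ℓ₂ → ℓ₂ < p₂ → 0 < ℓ₃ → ℓ₃ < p₃ →
  -- (i) P ≡ 2 (mod 4)
  (p₁ ℕ.* p₂ ℕ.* p₃) ℕ.% 4 ≡ 2 →
  -- (ii) χ(n) ≠ 0 ⇒ n odd
  (∀ (n : ℤ) → χ p₁ p₂ p₃ ℓ₁ ℓ₂ ℓ₃ n ≢ + 0 → ¬ (+ 2 ℤD.∣ n)) →
  -- (iii) χ(P - n) = χ(n)
  (∀ (n : ℤ) → χ p₁ p₂ p₃ ℓ₁ ℓ₂ ℓ₃ (+ (p₁ ℕ.* p₂ ℕ.* p₃) ℤ.- n) ≡ χ p₁ p₂ p₃ ℓ₁ ℓ₂ ℓ₃ n) →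
  (M N : ℕ) → 0 < M → 0 < N → Coprime M N →
  ∀ {c ℓ : Level} (R : CommutativeRing c ℓ) → IsDomain R → CharZero R →
  (ζ : CommutativeRing.Carrier R) → PrimitiveRoot R (4 ℕ.* (p₁ ℕ.* p₂ ℕ.* p₃) ℕ.* N) ζ →
  let open CommutativeRing R
      K = p₁ ℕ.* p₂ ℕ.* p₃ ℕ.* N
      -- χ(n) q^{n²/(4P)} with q^{n²/(4P)} = ζ^{M n²}, ζ = e^{2πi/(4PN)}
      term : ℕ → Carrier
      term n = intR R (χ p₁ p₂ p₃ ℓ₁ ℓ₂ ℓ₃ (+ n)) * pow R ζ (M ℕ.* n ℕ.* n)
  in natR R 2 * sumTo R K (λ n → natR R (K ∸ n) * term n) ≈ natR R K * sumTo R K term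
-- Only the oddness of χ, (i)–(iii) and gcd(M, N) = 1 are used.
lemma3p1 p₁ p₂ p₃ _ _ _ _ _ _ ℓ₁ ℓ₂ ℓ₃ _ _ _ _ _ _ P≡2[mod4] odd-support reflective M zero _ () _
lemma3p1 p₁ p₂ p₃ _ _ _ _ _ _ ℓ₁ ℓ₂ ℓ₃ _ _ _ _ _ _ P≡2[mod4] odd-support reflective M (suc N′) _ _ coprime
         R domain _ ζ ζ-primitive =
  sumTo-weight-symmetric R K term term-reflect
  where
  open ReflectionSymmetry R domain (χ p₁ p₂ p₃ ℓ₁ ℓ₂ ℓ₃) (χ-neg p₁ p₂ p₃ ℓ₁ ℓ₂ ℓ₃) (p₁ ℕ.* p₂ ℕ.* p₃) P≡2[mod4]
    odd-support reflective M N′ coprime ζ ζ-primitive
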